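{- Let $G_1$ be the cyclic permutation group on $\{1,\dots,14\}$ generated by the $14$-cycle $(1,2,3,4,5,6,7,8,9,10,11,12,13,14)$. Every non-trivial monotone non-increasing $G_1$-invariant boolean function $f(x_1,\dots,x_{14})$ is elusive.
   Context: Boolean functions of $x_1,\dots,x_n$ are viewed as functions on subsets $\boldsymbol{x}\subseteq\{x_1,\dots,x_n\}$. $f$ is elusive if its deterministic decision tree complexity $D(f)$ (minimum depth of a decision tree querying variables) equals $n$. $f$ is monotone non-increasing if $f(\boldsymbol{x})=1$ implies $f(\boldsymbol{x}')=1$ for all $\boldsymbol{x}'\subseteq\boldsymbol{x}$. A permutation $\sigma$ acts on inputs by $\sigma(\{x_{a_1},\dots,x_{a_m}\})=\{x_{\sigma(a_1)},\dots,x_{\sigma(a_m)}\}$; $f$ is $G$-invariant if $f(\sigma(\boldsymbol{x}))=f(\boldsymbol{x})$ for all $\sigma\in G$ and all $\boldsymbol{x}$. Non-trivial means non-constant. -}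

module Defs where

open import Data.Nat using (ℕ; zero; suc; _+_; _<_; _⊔_)
open import Data.Nat.DivMod using (_%_)
open import Data.Fin using (Fin; toℕ; fromℕ<)
open import Data.Nat.DivMod using (m%n<n)
open import Data.Bool using (Bool; true; false; if_then_else_; _≤_)
open import Relation.Binary.PropositionalEquality using (_≡_)
open import Data.Product using (∃; ∃₂; _×_)
open import Relation.Nullary using (¬_)

-- An input x ⊆ {x_1,…,x_n} is its characteristic function (true = variable present).
Input : ℕ → Set
Input n = Fin n → Bool

BoolFun : ℕ → Set
BoolFun n = Input n → Bool

data DTree (n : ℕ) : Set where
  leaf : Bool → DTree n
  node : Fin n → DTree n → DTree n → DTree n

eval : ∀ {n} → DTree n → Input n → Bool
eval (leaf b) x = b
eval (node i t₀ t₁) x = if x i then eval t₁ x else eval t₀ x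

depth : ∀ {n} → DTree n → ℕ
depth (leaf _) = 0
depth (node _ t₀ t₁) = suc (depth t₀ ⊔ depth t₁)

Computes : ∀ {n} → DTree n → BoolFun n → Set
Computes t f = ∀ x → eval t x ≡ f x

-- D(f) = n, i.e. no decision tree of depth < n computes f
-- (a tree of depth n always exists, so D(f) ≤ n holds trivially).
Elusive : ∀ {n} → BoolFun n → Set
Elusive {n} f = ∀ (t : DTree n) → Computes t f → ¬ (depth t < n)

_⊆_ : ∀ {n} → Input n → Input n → Set
x' ⊆ x = ∀ i → x' i ≤ x i

MonotoneNonIncreasing : ∀ {n} → BoolFun n → Set
MonotoneNonIncreasing f = ∀ x x' → x' ⊆ x → f x ≡ true → f x' ≡ true

NonTrivial : ∀ {n} → BoolFun n → Set
NonTrivial f = ∃₂ λ x y → ¬ (f x ≡ f y)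

rot : ∀ {m} → ℕ → Fin (suc m) → Fin (suc m)
rot {m} k a = fromℕ< (m%n<n (toℕ a + k) (suc m))

-- G₁ = ⟨(1 2 … 14)⟩ = { rot k : k ∈ ℕ } acting on Fin 14 (variable i ↔ index i-1).
-- Invariance under all of G₁: f(σ(x)) = f(x) for every σ = rot k.
-- σ(x) as a characteristic function is x ∘ σ⁻¹ = x ∘ rot (14 - k mod 14); since k
-- ranges over all of ℕ, quantifying f (x ∘ rot k) ≡ f x over all k is the same condition.
CyclicInvariant14 : BoolFun 14 → Set
CyclicInvariant14 f = ∀ (k : ℕ) (x : Input 14) → f (λ a → x (rot k a)) ≡ f x

-- Rivest and Vuillemin: if a decision tree of depth < n computes f, the subcube at each of its
-- leaves has a free variable, so the signed count Σₓ (-1)^|x| f(x) vanishes. Group the 14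
-- variables into 7 consecutive pairs. Rotation by two positions is then an action of ℤ/7 on
-- words of 7 pairs that preserves the summands of the signed count; its orbits other than the 4
-- constant words have size 7, so modulo 7 the signed count equals the contribution of
-- ∅, (01)⁷, (10)⁷ and the full set. Monotonicity and non-triviality give f(∅) = 1 and
-- f(full) = 0, and invariance under a single rotation gives f((01)⁷) = f((10)⁷), so these words
-- contribute 1 - 2 f((01)⁷) = ±1, which is not divisible by 7.
--
-- Orbits are never formed explicitly: a "phase" in ℤ/7, advanced by one by each rotation,
-- splits the non-constant words into seven classes of equal weight.
module Submission where

open import Defs
open import Data.Bool using (Bool; true; false; _∧_; _∨_; not; if_then_else_)
import Data.Bool.Base as 𝔹
open import Data.Bool.ListAction using (any; or)
import Data.Bool.Properties as Bool
open import Data.Bool.Properties using (∧-assoc; ∧-comm; ∧-zeroʳ; ∧-identityʳ; ∨-zeroʳ; if-float)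
open import Data.Fin using (Fin; zero; suc; toℕ)
import Data.Fin.Properties as Fin
open import Data.Integer using (ℤ; +_; 0ℤ; 1ℤ; -1ℤ; _+_; _*_; -_; ∣_∣)
import Data.Integer.Properties as ℤ
open import Data.Integer.Tactic.RingSolver using (solve-∀)
open import Data.List using (List; []; _∷_; _++_; map; cartesianProduct; allFin; length)
import Data.List.Properties as List
open import Data.Maybe using (Maybe; just; nothing)
open import Data.Nat as ℕ using (ℕ; zero; suc; z≤n; s≤s; _<_; _≤_; _⊔_; NonZero)
open import Data.Nat.Divisibility using (_∣_; divides)
open import Data.Nat.DivMod using (_%_; _mod_; m%n<n; [m+kn]%n≡m%n; %-distribˡ-+; m%n%n≡m%n; %-remove-+ʳ; m<n⇒m%n≡m)
import Data.Nat.Properties as ℕ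
open import Data.Nat.Tactic.RingSolver renaming (solve-∀ to ℕ-solve-∀)
open import Data.Product using (_×_; _,_)
open import Data.Product.Properties using (≡-dec)
open import Data.Vec as Vec using (Vec; []; _∷_; _∷ʳ_; lookup; replicate; _[_]≔_)
import Data.Vec.Properties as Vec
open import Function using (_∘_; _$_; id)
open import Relation.Binary.Definitions using (DecidableEquality)
open import Relation.Binary.PropositionalEquality
open import Relation.Nullary using (does; yes; no; contradiction)
open import Relation.Nullary.Decidable using (dec-true; dec-false)

private variable
  A B : Set
  m n : ℕ

sumOver : List A → (A → ℤ) → ℤ
sumOver []       g = 0ℤ
sumOver (x ∷ xs) g = g x + sumOver xs g

sumOver-cong : ∀ (xs : List A) {g h : A → ℤ} → (∀ x → g x ≡ h x) → sumOver xs g ≡ sumOver xs h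
sumOver-cong []       g≗h = refl
sumOver-cong (x ∷ xs) g≗h = cong₂ _+_ (g≗h x) (sumOver-cong xs g≗h)

sumOver-+ : ∀ (xs : List A) (g h : A → ℤ) → sumOver xs (λ x → g x + h x) ≡ sumOver xs g + sumOver xs h
sumOver-+ []       g h = refl
sumOver-+ (x ∷ xs) g h = trans (cong (_+_ (g x + h x)) (sumOver-+ xs g h)) (interchange (g x) (h x) _ _)
  where interchange : ∀ a b c d → a + b + (c + d) ≡ a + c + (b + d)
        interchange = solve-∀

sumOver-*ˡ : ∀ (xs : List A) c (g : A → ℤ) → sumOver xs (λ x → c * g x) ≡ c * sumOver xs g
sumOver-*ˡ []       c g = sym (ℤ.*-zeroʳ c)
sumOver-*ˡ (x ∷ xs) c g = trans (cong (_+_ (c * g x)) (sumOver-*ˡ xs c g)) (sym (ℤ.*-distribˡ-+ c (g x) _))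

sumOver-*ʳ : ∀ (xs : List A) (g : A → ℤ) c → sumOver xs g * c ≡ sumOver xs (λ x → g x * c)
sumOver-*ʳ xs g c = trans (ℤ.*-comm (sumOver xs g) c)
  (trans (sym (sumOver-*ˡ xs c g)) (sumOver-cong xs (λ x → ℤ.*-comm c (g x))))

sumOver-const : ∀ (xs : List A) c → sumOver xs (λ _ → c) ≡ + length xs * c
sumOver-const []       c = sym (ℤ.*-zeroˡ c)
sumOver-const (x ∷ xs) c = trans (cong (_+_ c) (sumOver-const xs c)) (sym (ℤ.suc-* (+ length xs) c))

sumOver-++ : ∀ (xs ys : List A) g → sumOver (xs ++ ys) g ≡ sumOver xs g + sumOver ys g
sumOver-++ []       ys g = sym (ℤ.+-identityˡ _)
sumOver-++ (x ∷ xs) ys g = trans (cong (_+_ (g x)) (sumOver-++ xs ys g)) (sym (ℤ.+-assoc (g x) _ _))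

sumOver-map : ∀ (f : A → B) xs g → sumOver (map f xs) g ≡ sumOver xs (g ∘ f)
sumOver-map f []       g = refl
sumOver-map f (x ∷ xs) g = cong (_+_ (g (f x))) (sumOver-map f xs g)

sumOver-cartesianProduct : ∀ (xs : List A) (ys : List B) g →
  sumOver (cartesianProduct xs ys) g ≡ sumOver xs (λ x → sumOver ys (λ y → g (x , y)))
sumOver-cartesianProduct []       ys g = refl
sumOver-cartesianProduct (x ∷ xs) ys g = begin
  sumOver (map (x ,_) ys ++ cartesianProduct xs ys) g
    ≡⟨ sumOver-++ (map (x ,_) ys) _ g ⟩
  sumOver (map (x ,_) ys) g + sumOver (cartesianProduct xs ys) g
    ≡⟨ cong₂ _+_ (sumOver-map (x ,_) ys g) (sumOver-cartesianProduct xs ys g) ⟩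
  sumOver ys (λ y → g (x , y)) + sumOver xs (λ x′ → sumOver ys (λ y → g (x′ , y))) ∎
  where open ≡-Reasoning

sumOver-comm : ∀ (xs : List A) (ys : List B) (g : A → B → ℤ) →
  sumOver xs (λ x → sumOver ys (λ y → g x y)) ≡ sumOver ys (λ y → sumOver xs (λ x → g x y))
sumOver-comm []       ys g = sym (trans (sumOver-const ys 0ℤ) (ℤ.*-zeroʳ (+ length ys)))
sumOver-comm (x ∷ xs) ys g = trans (cong (_+_ (sumOver ys (g x))) (sumOver-comm xs ys g))
                                   (sym (sumOver-+ ys (g x) _))

sumOver-allFin-suc : ∀ n (g : Fin (suc n) → ℤ) → sumOver (allFin (suc n)) g ≡ g zero + sumOver (allFin n) (g ∘ suc)
sumOver-allFin-suc n g =
  cong (_+_ (g zero)) (trans (cong (λ js → sumOver js g) (sym (List.map-tabulate id suc))) (sumOver-map suc (allFin n) g))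

rotateˡ : Vec A (suc n) → Vec A (suc n)
rotateˡ (x ∷ v) = v ∷ʳ x

unpair : Vec (A × A) n → Vec A (n ℕ.* 2)
unpair []            = []
unpair ((a , b) ∷ w) = a ∷ b ∷ unpair w

-- Kept opaque: otherwise unification unfolds sums over all 4⁷ words of Vec Bool² 7.
opaque
  sumVec : List A → (Vec A n → ℤ) → ℤ
  sumVec {n = zero}  xs g = g []
  sumVec {n = suc n} xs g = sumOver xs (λ x → sumVec xs (λ v → g (x ∷ v)))

  sumVec-cong : ∀ (xs : List A) {g h : Vec A n → ℤ} → (∀ v → g v ≡ h v) → sumVec xs g ≡ sumVec xs h
  sumVec-cong {n = zero} xs g≗h = g≗h []
  sumVec-cong {n = suc n} xs g≗h = sumOver-cong xs (λ x → sumVec-cong xs (λ v → g≗h (x ∷ v)))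

  sumVec-+ : ∀ (xs : List A) (g h : Vec A n → ℤ) → sumVec xs (λ v → g v + h v) ≡ sumVec xs g + sumVec xs h
  sumVec-+ {n = zero} xs g h = refl
  sumVec-+ {n = suc n} xs g h =
    trans (sumOver-cong xs (λ x → sumVec-+ xs (λ v → g (x ∷ v)) (λ v → h (x ∷ v)))) (sumOver-+ xs _ _)

  sumVec-*ˡ : ∀ (xs : List A) c (g : Vec A n → ℤ) → sumVec xs (λ v → c * g v) ≡ c * sumVec xs g
  sumVec-*ˡ {n = zero} xs c g = refl
  sumVec-*ˡ {n = suc n} xs c g =
    trans (sumOver-cong xs (λ x → sumVec-*ˡ xs c (λ v → g (x ∷ v)))) (sumOver-*ˡ xs c _)

  sumVec-sumOver : ∀ (xs : List A) (ys : List B) (g : B → Vec A n → ℤ) →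
    sumVec xs (λ v → sumOver ys (λ y → g y v)) ≡ sumOver ys (λ y → sumVec xs (g y))
  sumVec-sumOver {n = zero} xs ys g = refl
  sumVec-sumOver {n = suc n} xs ys g =
    trans (sumOver-cong xs (λ x → sumVec-sumOver xs ys (λ y v → g y (x ∷ v)))) (sumOver-comm xs ys _)

  sumVec-∷ʳ : ∀ (xs : List A) (g : Vec A (suc n) → ℤ) →
    sumOver xs (λ x → sumVec xs (λ v → g (v ∷ʳ x))) ≡ sumVec xs g
  sumVec-∷ʳ {n = zero} xs g = refl
  sumVec-∷ʳ {n = suc n} xs g =
    trans (sumOver-comm xs xs (λ x y → sumVec xs (λ v → g (y ∷ (v ∷ʳ x)))))
          (sumOver-cong xs (λ y → sumVec-∷ʳ xs (λ v → g (y ∷ v))))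

  sumVec-[] : ∀ (xs : List A) (g : Vec A 0 → ℤ) → sumVec xs g ≡ g []
  sumVec-[] xs g = refl

  sumVec-∷ : ∀ (xs : List A) (g : Vec A (suc n) → ℤ) →
    sumVec xs g ≡ sumOver xs (λ x → sumVec xs (λ v → g (x ∷ v)))
  sumVec-∷ xs g = refl

  sumVec-rotateˡ : ∀ (xs : List A) (g : Vec A (suc n) → ℤ) → sumVec xs (g ∘ rotateˡ) ≡ sumVec xs g
  sumVec-rotateˡ xs g = sumVec-∷ʳ xs g

  sumVec-unpair : ∀ (xs : List A) (g : Vec A (n ℕ.* 2) → ℤ) →
    sumVec xs g ≡ sumVec (cartesianProduct xs xs) (g ∘ unpair {n = n})
  sumVec-unpair {n = zero} xs g = refl
  sumVec-unpair {n = suc n} xs g = begin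
    sumOver xs (λ a → sumOver xs (λ b → sumVec xs (λ v → g (a ∷ b ∷ v))))
      ≡⟨ sumOver-cong xs (λ a → sumOver-cong xs (λ b → sumVec-unpair {n = n} xs (λ v → g (a ∷ b ∷ v)))) ⟩
    sumOver xs (λ a → sumOver xs (λ b → sumVec (cartesianProduct xs xs) (λ w → g (a ∷ b ∷ unpair {n = n} w))))
      ≡⟨ sym (sumOver-cartesianProduct xs xs _) ⟩
    sumVec (cartesianProduct xs xs) (g ∘ unpair {n = suc n}) ∎
    where open ≡-Reasoning

𝟙 : Bool → ℤ
𝟙 true  = 1ℤ
𝟙 false = 0ℤ

𝟙-∧ : ∀ a b → 𝟙 (a ∧ b) ≡ 𝟙 a * 𝟙 b
𝟙-∧ true  b = sym (ℤ.*-identityˡ (𝟙 b))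
𝟙-∧ false b = refl

𝟙-∧-* : ∀ a b z → 𝟙 (a ∧ b) * z ≡ 𝟙 a * (𝟙 b * z)
𝟙-∧-* a b z = trans (cong (_* z) (𝟙-∧ a b)) (ℤ.*-assoc (𝟙 a) (𝟙 b) z)

𝟙-split : ∀ b z → z ≡ 𝟙 b * z + 𝟙 (not b) * z
𝟙-split true  z = sym (trans (cong₂ _+_ (ℤ.*-identityˡ z) (ℤ.*-zeroˡ z)) (ℤ.+-identityʳ z))
𝟙-split false z = sym (trans (cong₂ _+_ (ℤ.*-zeroˡ z) (ℤ.*-identityˡ z)) (ℤ.+-identityˡ z))

∧-congʳ-true : ∀ {a b} c → (c ≡ true → a ≡ b) → a ∧ c ≡ b ∧ c
∧-congʳ-true {a} {b} true  a≡b = trans (∧-identityʳ a) (trans (a≡b refl) (sym (∧-identityʳ b)))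
∧-congʳ-true {a} {b} false _   = trans (∧-zeroʳ a) (sym (∧-zeroʳ b))

sumOver-allFin-δ : ∀ n (i : Fin n) (g : Fin n → ℤ) → sumOver (allFin n) (λ j → 𝟙 (does (i Fin.≟ j)) * g j) ≡ g i
sumOver-allFin-δ (suc n) zero    g = begin
  sumOver (allFin (suc n)) (λ j → 𝟙 (does (zero Fin.≟ j)) * g j)
    ≡⟨ sumOver-allFin-suc n (λ j → 𝟙 (does (zero Fin.≟ j)) * g j) ⟩
  1ℤ * g zero + sumOver (allFin n) (λ j → 0ℤ * g (suc j))
    ≡⟨ cong (_+_ (1ℤ * g zero)) (trans (sumOver-*ˡ (allFin n) 0ℤ (g ∘ suc))
                                       (ℤ.*-zeroˡ (sumOver (allFin n) (g ∘ suc)))) ⟩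
  1ℤ * g zero + 0ℤ
    ≡⟨ trans (ℤ.+-identityʳ _) (ℤ.*-identityˡ (g zero)) ⟩
  g zero ∎
  where open ≡-Reasoning
sumOver-allFin-δ (suc n) (suc i) g = begin
  sumOver (allFin (suc n)) (λ j → 𝟙 (does (suc i Fin.≟ j)) * g j)
    ≡⟨ sumOver-allFin-suc n (λ j → 𝟙 (does (suc i Fin.≟ j)) * g j) ⟩
  0ℤ * g zero + sumOver (allFin n) (λ j → 𝟙 (does (i Fin.≟ j)) * g (suc j))
    ≡⟨ cong (_+_ (0ℤ * g zero)) (sumOver-allFin-δ n i (g ∘ suc)) ⟩
  0ℤ * g zero + g (suc i)
    ≡⟨ trans (cong (_+ g (suc i)) (ℤ.*-zeroˡ (g zero))) (ℤ.+-identityˡ _) ⟩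
  g (suc i) ∎
  where open ≡-Reasoning

-- The Rivest–Vuillemin criterion

bools : List Bool
bools = false ∷ true ∷ []

signBit : Bool → ℤ
signBit false = 1ℤ
signBit true  = -1ℤ

sign : Vec Bool n → ℤ
sign []      = 1ℤ
sign (b ∷ v) = signBit b * sign v

-- nothing marks a free variable.
Restriction : ℕ → Set
Restriction n = Vec (Maybe Bool) n

agrees : Restriction n → Vec Bool n → Bool
agrees []            []      = true
agrees (nothing ∷ ρ) (b ∷ v) = agrees ρ v
agrees (just c ∷ ρ)  (b ∷ v) = does (c Bool.≟ b) ∧ agrees ρ v

free : Restriction n → ℕ
free []            = 0
free (nothing ∷ ρ) = suc (free ρ)
free (just _ ∷ ρ)  = free ρ

agrees-fix : ∀ (ρ : Restriction n) i b v → lookup ρ i ≡ nothing →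
  agrees (ρ [ i ]≔ just b) v ≡ agrees ρ v ∧ does (b Bool.≟ lookup v i)
agrees-fix (nothing ∷ ρ) zero    b (x ∷ v) _  = ∧-comm (does (b Bool.≟ x)) (agrees ρ v)
agrees-fix (nothing ∷ ρ) (suc i) b (x ∷ v) ρi = agrees-fix ρ i b v ρi
agrees-fix (just c ∷ ρ)  (suc i) b (x ∷ v) ρi =
  trans (cong (does (c Bool.≟ x) ∧_) (agrees-fix ρ i b v ρi)) (sym (∧-assoc (does (c Bool.≟ x)) _ _))

free-fix : ∀ (ρ : Restriction n) i b → lookup ρ i ≡ nothing → suc (free (ρ [ i ]≔ just b)) ≡ free ρ
free-fix (nothing ∷ ρ) zero    b _  = refl
free-fix (nothing ∷ ρ) (suc i) b ρi = cong suc (free-fix ρ i b ρi)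
free-fix (just _ ∷ ρ)  (suc i) b ρi = free-fix ρ i b ρi

agrees⇒lookup : ∀ (ρ : Restriction n) i {c} v → lookup ρ i ≡ just c → agrees ρ v ≡ true → lookup v i ≡ c
agrees⇒lookup (just c ∷ ρ) zero    (x ∷ v) refl ρv with c Bool.≟ x
... | yes c≡x = sym c≡x
agrees⇒lookup (r ∷ ρ)      (suc i) (x ∷ v) ρi   ρv = agrees⇒lookup ρ i v ρi (tail-true r x ρv)
  where
  tail-true : ∀ r x → agrees (r ∷ ρ) (x ∷ v) ≡ true → agrees ρ v ≡ true
  tail-true nothing  x ρv = ρv
  tail-true (just c) x ρv with does (c Bool.≟ x)
  ... | true = ρv

agrees-unrestricted : ∀ (v : Vec Bool n) → agrees (replicate n nothing) v ≡ true
agrees-unrestricted []      = refl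
agrees-unrestricted (b ∷ v) = agrees-unrestricted v

free-unrestricted : ∀ n → free (replicate n nothing) ≡ n
free-unrestricted zero    = refl
free-unrestricted (suc n) = cong suc (free-unrestricted n)

signedSum : Restriction n → (Vec Bool n → Bool) → ℤ
signedSum ρ g = sumVec bools (λ v → 𝟙 (g v ∧ agrees ρ v) * sign v)

signedSum-cong : ∀ (ρ : Restriction n) {g h} → (∀ v → g v ∧ agrees ρ v ≡ h v ∧ agrees ρ v) →
  signedSum ρ g ≡ signedSum ρ h
signedSum-cong ρ g≗h = sumVec-cong bools (λ v → cong (λ b → 𝟙 b * sign v) (g≗h v))

-- Flipping a free variable flips the sign.
signedSum-subcube : ∀ (ρ : Restriction n) → 0 < free ρ → signedSum ρ (λ _ → true) ≡ 0ℤ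
signedSum-subcube (nothing ∷ ρ) _ = begin
  signedSum (nothing ∷ ρ) (λ _ → true)
    ≡⟨ sumVec-∷ bools _ ⟩
  sumOver bools (λ b → sumVec bools (λ v → 𝟙 (agrees ρ v) * (signBit b * sign v)))
    ≡⟨ sumOver-cong bools (λ b → trans (sumVec-cong bools (λ v → swap (𝟙 (agrees ρ v)) (signBit b) (sign v)))
                                       (sumVec-*ˡ bools (signBit b) (λ v → 𝟙 (agrees ρ v) * sign v))) ⟩
  1ℤ * S + (-1ℤ * S + 0ℤ)
    ≡⟨ cancel S ⟩
  0ℤ ∎
  where
  open ≡-Reasoning
  S : ℤ
  S = signedSum ρ (λ _ → true)
  swap : ∀ a b c → a * (b * c) ≡ b * (a * c)
  swap = solve-∀
  cancel : ∀ s → 1ℤ * s + (-1ℤ * s + 0ℤ) ≡ 0ℤ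
  cancel = solve-∀
signedSum-subcube (just c ∷ ρ) ρ-free = trans (sumVec-∷ bools _) $
  sumOver-cong bools (λ b → begin
    sumVec bools (λ v → 𝟙 (does (c Bool.≟ b) ∧ agrees ρ v) * (signBit b * sign v))
      ≡⟨ sumVec-cong bools (λ v → factor (does (c Bool.≟ b)) (agrees ρ v) (signBit b) (sign v)) ⟩
    sumVec bools (λ v → coefficient b * (𝟙 (agrees ρ v) * sign v))
      ≡⟨ sumVec-*ˡ bools (coefficient b) (λ v → 𝟙 (agrees ρ v) * sign v) ⟩
    coefficient b * signedSum ρ (λ _ → true)
      ≡⟨ cong (coefficient b *_) (signedSum-subcube ρ ρ-free) ⟩
    coefficient b * 0ℤ
      ≡⟨ ℤ.*-zeroʳ (coefficient b) ⟩
    0ℤ ∎)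
  where
  open ≡-Reasoning
  coefficient : Bool → ℤ
  coefficient b = 𝟙 (does (c Bool.≟ b)) * signBit b
  factor : ∀ d a s t → 𝟙 (d ∧ a) * (s * t) ≡ (𝟙 d * s) * (𝟙 a * t)
  factor d a s t = trans (cong (_* (s * t)) (𝟙-∧ d a)) (rearrange (𝟙 d) (𝟙 a) s t)
    where rearrange : ∀ x y s t → x * y * (s * t) ≡ x * s * (y * t)
          rearrange = solve-∀

signedSum-fixed : ∀ (ρ : Restriction n) i {c} t₀ t₁ → lookup ρ i ≡ just c →
  signedSum ρ (eval (node i t₀ t₁) ∘ lookup) ≡ signedSum ρ (eval (if c then t₁ else t₀) ∘ lookup)
signedSum-fixed ρ i {c} t₀ t₁ ρi = signedSum-cong ρ (λ v → ∧-congʳ-true (agrees ρ v) (λ ρv →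
  trans (cong (λ x → if x then eval t₁ (lookup v) else eval t₀ (lookup v)) (agrees⇒lookup ρ i v ρi ρv))
        (sym (if-float (λ t → eval t (lookup v)) c))))

signedSum-free : ∀ (ρ : Restriction n) i t₀ t₁ → lookup ρ i ≡ nothing →
  signedSum ρ (eval (node i t₀ t₁) ∘ lookup)
    ≡ signedSum (ρ [ i ]≔ just false) (eval t₀ ∘ lookup) + signedSum (ρ [ i ]≔ just true) (eval t₁ ∘ lookup)
signedSum-free ρ i t₀ t₁ ρi = trans (sumVec-cong bools split) (sumVec-+ bools (term false t₀) (term true t₁))
  where
  term : Bool → DTree _ → Vec Bool _ → ℤ
  term b t v = 𝟙 (eval t (lookup v) ∧ agrees (ρ [ i ]≔ just b) v) * sign v
  split : ∀ v → 𝟙 (eval (node i t₀ t₁) (lookup v) ∧ agrees ρ v) * sign v ≡ term false t₀ v + term true t₁ v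
  split v rewrite agrees-fix ρ i false v ρi | agrees-fix ρ i true v ρi with lookup v i
  ... | false rewrite ∧-identityʳ (agrees ρ v) | ∧-zeroʳ (agrees ρ v) | ∧-zeroʳ (eval t₁ (lookup v)) =
    sym (ℤ.+-identityʳ _)
  ... | true  rewrite ∧-identityʳ (agrees ρ v) | ∧-zeroʳ (agrees ρ v) | ∧-zeroʳ (eval t₀ (lookup v)) =
    sym (ℤ.+-identityˡ _)

-- Rivest–Vuillemin: a query either follows a fixed variable or splits ρ into two restrictions
-- with one free variable fewer, so every leaf lies over a subcube with a free variable.
signedSum-shallow : ∀ (t : DTree n) (ρ : Restriction n) → depth t < free ρ → signedSum ρ (eval t ∘ lookup) ≡ 0ℤ
signedSum-shallow (leaf true)        ρ ρ-free = signedSum-subcube ρ ρ-free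
signedSum-shallow {n} (leaf false)   ρ _      = sumVec-*ˡ bools 0ℤ (sign {n})  -- 𝟙 (false ∧ _) is 0ℤ
signedSum-shallow (node i t₀ t₁) ρ deep with lookup ρ i in ρi
... | just false = trans (signedSum-fixed ρ i t₀ t₁ ρi)
                         (signedSum-shallow t₀ ρ (ℕ.<-trans (s≤s (ℕ.m≤m⊔n (depth t₀) (depth t₁))) deep))
... | just true  = trans (signedSum-fixed ρ i t₀ t₁ ρi)
                         (signedSum-shallow t₁ ρ (ℕ.<-trans (s≤s (ℕ.m≤n⊔m (depth t₀) (depth t₁))) deep))
... | nothing    = trans (signedSum-free ρ i t₀ t₁ ρi) (cong₂ _+_
  (signedSum-shallow t₀ (ρ [ i ]≔ just false) (shallower (ℕ.m≤m⊔n (depth t₀) (depth t₁)) (free-fix ρ i false ρi)))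
  (signedSum-shallow t₁ (ρ [ i ]≔ just true) (shallower (ℕ.m≤n⊔m (depth t₀) (depth t₁)) (free-fix ρ i true ρi))))
  where
  shallower : ∀ {d k} → d ≤ depth t₀ ⊔ depth t₁ → suc k ≡ free ρ → d < k
  shallower d≤ fixed = ℕ.≤-<-trans d≤ (ℕ.s<s⁻¹ (subst (suc (depth t₀ ⊔ depth t₁) <_) (sym fixed) deep))

signedCount : BoolFun n → ℤ
signedCount f = sumVec bools (λ v → 𝟙 (f (lookup v)) * sign v)

signedCount≢0⇒elusive : ∀ (f : BoolFun n) → signedCount f ≢ 0ℤ → Elusive f
signedCount≢0⇒elusive {n} f nonzero t computes shallow = nonzero (begin
  signedCount f
    ≡⟨ sumVec-cong bools (λ v → cong (λ b → 𝟙 b * sign v)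
         (trans (cong (eval t (lookup v) ∧_) (agrees-unrestricted v)) (trans (∧-identityʳ _) (computes (lookup v))))) ⟨
  signedSum (replicate n nothing) (eval t ∘ lookup)
    ≡⟨ signedSum-shallow t (replicate n nothing) (subst (depth t <_) (sym (free-unrestricted n)) shallow) ⟩
  0ℤ ∎)
  where open ≡-Reasoning

rot-cong : ∀ k (a : Fin (suc m)) l b → (toℕ a ℕ.+ k) % suc m ≡ (toℕ b ℕ.+ l) % suc m → rot k a ≡ rot l b
rot-cong k a l b eq = Fin.fromℕ<-cong _ _ eq _ _

rot-≡ : ∀ k (a b : Fin (suc m)) → (toℕ a ℕ.+ k) % suc m ≡ toℕ b → rot k a ≡ b
rot-≡ k a b eq = trans (Fin.fromℕ<-cong _ _ eq _ (Fin.toℕ<n b)) (Fin.fromℕ<-toℕ b (Fin.toℕ<n b))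

rot-rot : ∀ k l (a : Fin (suc m)) → rot l (rot k a) ≡ rot (l ℕ.+ k) a
rot-rot {m} k l a = rot-cong l (rot k a) (l ℕ.+ k) a (begin
  (toℕ (rot k a) ℕ.+ l) % suc m
    ≡⟨ cong (λ r → (r ℕ.+ l) % suc m) (Fin.toℕ-fromℕ< (m%n<n (toℕ a ℕ.+ k) (suc m))) ⟩
  ((toℕ a ℕ.+ k) % suc m ℕ.+ l) % suc m      ≡⟨ %-absorbˡ (toℕ a ℕ.+ k) l ⟩
  (toℕ a ℕ.+ k ℕ.+ l) % suc m                ≡⟨ cong (_% suc m) (shuffle (toℕ a) k l) ⟩
  (toℕ a ℕ.+ (l ℕ.+ k)) % suc m ∎)
  where
  open ≡-Reasoning
  %-absorbˡ : ∀ x y → (x % suc m ℕ.+ y) % suc m ≡ (x ℕ.+ y) % suc m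
  %-absorbˡ x y = begin
    (x % suc m ℕ.+ y) % suc m                  ≡⟨ %-distribˡ-+ (x % suc m) y (suc m) ⟩
    (x % suc m % suc m ℕ.+ y % suc m) % suc m  ≡⟨ cong (λ r → (r ℕ.+ y % suc m) % suc m) (m%n%n≡m%n x (suc m)) ⟩
    (x % suc m ℕ.+ y % suc m) % suc m          ≡⟨ %-distribˡ-+ x y (suc m) ⟨
    (x ℕ.+ y) % suc m ∎
  shuffle : ∀ a k l → a ℕ.+ k ℕ.+ l ≡ a ℕ.+ (l ℕ.+ k)
  shuffle = ℕ-solve-∀

rot-multiple : ∀ {k} → suc m ∣ k → (a : Fin (suc m)) → rot k a ≡ a
rot-multiple {k = k} m∣k a = rot-≡ k a a (trans (%-remove-+ʳ (toℕ a) m∣k) (m<n⇒m%n≡m (Fin.toℕ<n a)))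

rot-1-injective : ∀ {a b : Fin (suc m)} → rot 1 a ≡ rot 1 b → a ≡ b
rot-1-injective {m} {a} {b} eq = begin
  a                ≡⟨ rot-multiple period a ⟨
  rot (m ℕ.+ 1) a  ≡⟨ rot-rot 1 m a ⟨
  rot m (rot 1 a)  ≡⟨ cong (rot m) eq ⟩
  rot m (rot 1 b)  ≡⟨ rot-rot 1 m b ⟩
  rot (m ℕ.+ 1) b  ≡⟨ rot-multiple period b ⟩
  b ∎
  where
  open ≡-Reasoning
  period : suc m ∣ m ℕ.+ 1
  period = divides 1 (trans (ℕ.+-comm m 1) (sym (ℕ.*-identityˡ (suc m))))

does-rot-1 : ∀ (a b : Fin (suc m)) → does (rot 1 a Fin.≟ rot 1 b) ≡ does (a Fin.≟ b)
does-rot-1 a b with a Fin.≟ b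
... | yes refl = dec-true (rot 1 a Fin.≟ rot 1 a) refl
... | no  a≢b  = dec-false (rot 1 a Fin.≟ rot 1 b) (a≢b ∘ rot-1-injective)

rot-1-invariant⇒constant : ∀ (C : Fin (suc m) → ℤ) → (∀ j → C (rot 1 j) ≡ C j) → ∀ j → C j ≡ C zero
rot-1-invariant⇒constant C invariant j =
  trans (cong C (sym (rot-≡ (toℕ j) zero j (m<n⇒m%n≡m (Fin.toℕ<n j))))) (orbit (toℕ j))
  where
  orbit : ∀ k → C (rot k zero) ≡ C zero
  orbit zero    = refl
  orbit (suc k) = trans (cong C (sym (rot-rot k 1 zero))) (trans (invariant (rot k zero)) (orbit k))

Bool² : Set
Bool² = Bool × Bool

_≟²_ : DecidableEquality Bool²
_≟²_ = ≡-dec Bool._≟_ Bool._≟_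

pairs : List Bool²
pairs = cartesianProduct bools bools

sumOver-pairs-δ : ∀ q (g : Bool² → ℤ) → sumOver pairs (λ x → 𝟙 (does (q ≟² x)) * g x) ≡ g q
sumOver-pairs-δ (false , false) g = δ₀ (g (false , false)) (g (false , true)) (g (true , false)) (g (true , true))
  where δ₀ : ∀ a b c d → 1ℤ * a + (0ℤ * b + (0ℤ * c + (0ℤ * d + 0ℤ))) ≡ a
        δ₀ = solve-∀
sumOver-pairs-δ (false , true)  g = δ₁ (g (false , false)) (g (false , true)) (g (true , false)) (g (true , true))
  where δ₁ : ∀ a b c d → 0ℤ * a + (1ℤ * b + (0ℤ * c + (0ℤ * d + 0ℤ))) ≡ b
        δ₁ = solve-∀
sumOver-pairs-δ (true , false)  g = δ₂ (g (false , false)) (g (false , true)) (g (true , false)) (g (true , true))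
  where δ₂ : ∀ a b c d → 0ℤ * a + (0ℤ * b + (1ℤ * c + (0ℤ * d + 0ℤ))) ≡ c
        δ₂ = solve-∀
sumOver-pairs-δ (true , true)   g = δ₃ (g (false , false)) (g (false , true)) (g (true , false)) (g (true , true))
  where δ₃ : ∀ a b c d → 0ℤ * a + (0ℤ * b + (0ℤ * c + (1ℤ * d + 0ℤ))) ≡ d
        δ₃ = solve-∀

count : Bool² → Vec Bool² n → ℕ
count q = Vec.count (q ≟²_)

count-∷ : ∀ q x (w : Vec Bool² n) → count q (x ∷ w) ≡ count q (x ∷ []) ℕ.+ count q w
count-∷ q x w with does (q ≟² x)
... | true  = refl
... | false = refl

count-∷ʳ : ∀ q (w : Vec Bool² n) x → count q (w ∷ʳ x) ≡ count q w ℕ.+ count q (x ∷ [])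
count-∷ʳ q []      x = refl
count-∷ʳ q (y ∷ w) x = begin
  count q (y ∷ (w ∷ʳ x))                                ≡⟨ count-∷ q y (w ∷ʳ x) ⟩
  count q (y ∷ []) ℕ.+ count q (w ∷ʳ x)                  ≡⟨ cong (ℕ._+_ (count q (y ∷ []))) (count-∷ʳ q w x) ⟩
  count q (y ∷ []) ℕ.+ (count q w ℕ.+ count q (x ∷ []))  ≡⟨ ℕ.+-assoc (count q (y ∷ [])) _ _ ⟨
  count q (y ∷ []) ℕ.+ count q w ℕ.+ count q (x ∷ [])    ≡⟨ cong (ℕ._+ count q (x ∷ [])) (count-∷ q y w) ⟨
  count q (y ∷ w) ℕ.+ count q (x ∷ []) ∎
  where open ≡-Reasoning

count-rotateˡ : ∀ q (w : Vec Bool² (suc n)) → count q (rotateˡ w) ≡ count q w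
count-rotateˡ q (x ∷ w) = trans (count-∷ʳ q w x) (trans (ℕ.+-comm (count q w) _) (sym (count-∷ q x w)))

count-total : ∀ (w : Vec Bool² n) →
  count (false , false) w ℕ.+ (count (false , true) w ℕ.+ (count (true , false) w ℕ.+ count (true , true) w)) ≡ n
count-total []      = refl
count-total (x ∷ w) = trans (step x) (cong suc (count-total w))
  where
  a b c d : ℕ
  a = count (false , false) w
  b = count (false , true) w
  c = count (true , false) w
  d = count (true , true) w
  step : ∀ x → count (false , false) (x ∷ w) ℕ.+ (count (false , true) (x ∷ w) ℕ.+
                (count (true , false) (x ∷ w) ℕ.+ count (true , true) (x ∷ w))) ≡ suc (a ℕ.+ (b ℕ.+ (c ℕ.+ d)))
  step (false , false) = refl
  step (false , true)  = ℕ.+-suc a (b ℕ.+ (c ℕ.+ d))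
  step (true , false)  = shuffle a b c d
    where shuffle : ∀ a b c d → a ℕ.+ (b ℕ.+ (suc c ℕ.+ d)) ≡ suc (a ℕ.+ (b ℕ.+ (c ℕ.+ d)))
          shuffle = ℕ-solve-∀
  step (true , true)   = shuffle a b c d
    where shuffle : ∀ a b c d → a ℕ.+ (b ℕ.+ (c ℕ.+ suc d)) ≡ suc (a ℕ.+ (b ℕ.+ (c ℕ.+ d)))
          shuffle = ℕ-solve-∀

-- The sum of the positions (from 0) at which q occurs.
positionSum : Bool² → Vec Bool² n → ℕ
positionSum q []      = 0
positionSum q (x ∷ w) = count q w ℕ.+ positionSum q w

positionSum-∷ʳ : ∀ q (w : Vec Bool² n) x → positionSum q (w ∷ʳ x) ≡ positionSum q w ℕ.+ n ℕ.* count q (x ∷ [])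
positionSum-∷ʳ q []      x = refl
positionSum-∷ʳ {suc n} q (y ∷ w) x
  rewrite count-∷ʳ q w x | positionSum-∷ʳ q w x = shuffle (count q w) (positionSum q w) (count q (x ∷ [])) n
  where shuffle : ∀ c p e n → c ℕ.+ e ℕ.+ (p ℕ.+ n ℕ.* e) ≡ c ℕ.+ p ℕ.+ (e ℕ.+ n ℕ.* e)
        shuffle = ℕ-solve-∀

-- Rotation moves every occurrence of q one position down, except at the head, which moves to the end.
positionSum-rotateˡ : ∀ q x (w : Vec Bool² n) →
  positionSum q (rotateˡ (x ∷ w)) ℕ.+ count q (x ∷ w) ≡ positionSum q (x ∷ w) ℕ.+ count q (x ∷ []) ℕ.* suc n
positionSum-rotateˡ {n} q x w rewrite positionSum-∷ʳ q w x | count-∷ q x w =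
  shuffle (count q w) (positionSum q w) (count q (x ∷ [])) n
  where shuffle : ∀ c p e n → p ℕ.+ n ℕ.* e ℕ.+ (e ℕ.+ c) ≡ c ℕ.+ p ℕ.+ e ℕ.* suc n
        shuffle = ℕ-solve-∀

firstPresent : ℕ → ℕ → ℕ → Bool²
firstPresent (suc _) _       _       = (false , false)
firstPresent zero    (suc _) _       = (false , true)
firstPresent zero    zero    (suc _) = (true , false)
firstPresent zero    zero    zero    = (true , true)

-- A letter of w that depends only on the letter counts, hence is invariant under rotation.
leader : Vec Bool² n → Bool²
leader w = firstPresent (count (false , false) w) (count (false , true) w) (count (true , false) w)

leader-rotateˡ : ∀ (w : Vec Bool² (suc n)) → leader (rotateˡ w) ≡ leader w
leader-rotateˡ w
  rewrite count-rotateˡ (false , false) w | count-rotateˡ (false , true) w | count-rotateˡ (true , false) w = refl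

firstPresent-present : ∀ (g : Bool² → ℕ) →
  0 < g (false , false) ℕ.+ (g (false , true) ℕ.+ (g (true , false) ℕ.+ g (true , true))) →
  0 < g (firstPresent (g (false , false)) (g (false , true)) (g (true , false)))
firstPresent-present g total with g (false , false) in e₀ | g (false , true) in e₁ | g (true , false) in e₂
... | suc _ | _     | _     = subst (0 <_) (sym e₀) (s≤s z≤n)
... | zero  | suc _ | _     = subst (0 <_) (sym e₁) (s≤s z≤n)
... | zero  | zero  | suc _ = subst (0 <_) (sym e₂) (s≤s z≤n)
... | zero  | zero  | zero  = total

leader-present : ∀ (w : Vec Bool² (suc n)) → 0 < count (leader w) w
leader-present w = firstPresent-present (λ q → count q w) (subst (0 <_) (sym (count-total w)) (s≤s z≤n))

allEqual : Bool² → Vec Bool² n → Bool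
allEqual q []      = true
allEqual q (x ∷ w) = does (q ≟² x) ∧ allEqual q w

isConstant : Vec Bool² n → Bool
isConstant w = any (λ q → allEqual q w) pairs

allEqual-∷ʳ : ∀ q (w : Vec Bool² n) x → allEqual q (w ∷ʳ x) ≡ allEqual q w ∧ does (q ≟² x)
allEqual-∷ʳ q []      x = ∧-comm (does (q ≟² x)) true
allEqual-∷ʳ q (y ∷ w) x =
  trans (cong (does (q ≟² y) ∧_) (allEqual-∷ʳ q w x)) (sym (∧-assoc (does (q ≟² y)) _ _))

allEqual-rotateˡ : ∀ q (w : Vec Bool² (suc n)) → allEqual q (rotateˡ w) ≡ allEqual q w
allEqual-rotateˡ q (x ∷ w) = trans (allEqual-∷ʳ q w x) (∧-comm (allEqual q w) _)

isConstant-rotateˡ : ∀ (w : Vec Bool² (suc n)) → isConstant (rotateˡ w) ≡ isConstant w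
isConstant-rotateˡ w = cong or (List.map-cong (λ q → allEqual-rotateˡ q w) pairs)

count≡length⇒allEqual : ∀ q (w : Vec Bool² n) → count q w ≡ n → allEqual q w ≡ true
count≡length⇒allEqual q []      _ = refl
count≡length⇒allEqual q (x ∷ w) full with does (q ≟² x)
... | true  = count≡length⇒allEqual q w (ℕ.suc-injective full)
... | false = contradiction (subst (ℕ._≤ _) full (Vec.count≤n (q ≟²_) w)) ℕ.1+n≰n

allEqual⇒isConstant : ∀ q (w : Vec Bool² n) → allEqual q w ≡ true → isConstant w ≡ true
allEqual⇒isConstant (false , false) w eq rewrite eq = refl
allEqual⇒isConstant (false , true)  w eq rewrite eq = ∨-zeroʳ (allEqual _ w)
allEqual⇒isConstant (true , false)  w eq rewrite eq =
  trans (cong (allEqual (false , false) w ∨_) (∨-zeroʳ (allEqual (false , true) w))) (∨-zeroʳ _)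
allEqual⇒isConstant (true , true)   w eq rewrite eq =
  trans (cong (λ b → allEqual (false , false) w ∨ (allEqual (false , true) w ∨ b)) (∨-zeroʳ (allEqual (true , false) w)))
        (trans (cong (allEqual (false , false) w ∨_) (∨-zeroʳ (allEqual (false , true) w))) (∨-zeroʳ _))

𝟙-isConstant : ∀ (w : Vec Bool² (suc n)) → 𝟙 (isConstant w) ≡ sumOver pairs (λ q → 𝟙 (allEqual q w))
𝟙-isConstant ((false , false) ∷ w) with allEqual (false , false) w
... | true  = refl
... | false = refl
𝟙-isConstant ((false , true)  ∷ w) with allEqual (false , true) w
... | true  = refl
... | false = refl
𝟙-isConstant ((true , false)  ∷ w) with allEqual (true , false) w
... | true  = refl
... | false = refl
𝟙-isConstant ((true , true)   ∷ w) with allEqual (true , true) w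
... | true  = refl
... | false = refl

sumVec-allEqual : ∀ q (h : Vec Bool² n → ℤ) → sumVec pairs (λ w → 𝟙 (allEqual q w) * h w) ≡ h (replicate n q)
sumVec-allEqual {zero}  q h = trans (sumVec-[] pairs _) (ℤ.*-identityˡ (h []))
sumVec-allEqual {suc n} q h = begin
  sumVec pairs (λ w → 𝟙 (allEqual q w) * h w)
    ≡⟨ sumVec-∷ pairs _ ⟩
  sumOver pairs (λ x → sumVec pairs (λ w → 𝟙 (does (q ≟² x) ∧ allEqual q w) * h (x ∷ w)))
    ≡⟨ sumOver-cong pairs (λ x → trans (sumVec-cong pairs (λ w → 𝟙-∧-* (does (q ≟² x)) (allEqual q w) (h (x ∷ w))))
                                       (sumVec-*ˡ pairs (𝟙 (does (q ≟² x))) (λ w → 𝟙 (allEqual q w) * h (x ∷ w)))) ⟩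
  sumOver pairs (λ x → 𝟙 (does (q ≟² x)) * sumVec pairs (λ w → 𝟙 (allEqual q w) * h (x ∷ w)))
    ≡⟨ sumOver-pairs-δ q (λ x → sumVec pairs (λ w → 𝟙 (allEqual q w) * h (x ∷ w))) ⟩
  sumVec pairs (λ w → 𝟙 (allEqual q w) * h (q ∷ w))
    ≡⟨ sumVec-allEqual q (λ w → h (q ∷ w)) ⟩
  h (replicate (suc n) q) ∎
  where
  open ≡-Reasoning

-- Orbit counting modulo 7

-- A factor u with u m ≡ -1 (mod d) turns the drift S′ ≡ S - m of a position sum into a unit step.
mod-step : ∀ {d} .{{_ : NonZero d}} {u m S S′ e} → d ∣ u ℕ.* m ℕ.+ 1 → S′ ℕ.+ m ≡ S ℕ.+ e ℕ.* d →
  (u ℕ.* S′) % d ≡ (1 ℕ.+ u ℕ.* S) % d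
mod-step {d} {u} {m} {S} {S′} {e} (divides q um+1≡qd) drift = begin
  (u ℕ.* S′) % d                           ≡⟨ [m+kn]%n≡m%n (u ℕ.* S′) q d ⟨
  (u ℕ.* S′ ℕ.+ q ℕ.* d) % d               ≡⟨ cong (λ x → (u ℕ.* S′ ℕ.+ x) % d) um+1≡qd ⟨
  (u ℕ.* S′ ℕ.+ (u ℕ.* m ℕ.+ 1)) % d       ≡⟨ cong (_% d) (shuffle₁ u S′ m) ⟩
  (1 ℕ.+ u ℕ.* (S′ ℕ.+ m)) % d             ≡⟨ cong (λ x → (1 ℕ.+ u ℕ.* x) % d) drift ⟩
  (1 ℕ.+ u ℕ.* (S ℕ.+ e ℕ.* d)) % d        ≡⟨ cong (_% d) (shuffle₂ u S e d) ⟩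
  (1 ℕ.+ u ℕ.* S ℕ.+ (u ℕ.* e) ℕ.* d) % d  ≡⟨ [m+kn]%n≡m%n (1 ℕ.+ u ℕ.* S) (u ℕ.* e) d ⟩
  (1 ℕ.+ u ℕ.* S) % d ∎
  where
  open ≡-Reasoning
  shuffle₁ : ∀ u S′ m → u ℕ.* S′ ℕ.+ (u ℕ.* m ℕ.+ 1) ≡ 1 ℕ.+ u ℕ.* (S′ ℕ.+ m)
  shuffle₁ = ℕ-solve-∀
  shuffle₂ : ∀ u S e d → 1 ℕ.+ u ℕ.* (S ℕ.+ e ℕ.* d) ≡ 1 ℕ.+ u ℕ.* S ℕ.+ (u ℕ.* e) ℕ.* d
  shuffle₂ = ℕ-solve-∀

negInverse₇ : ℕ → ℕ
negInverse₇ 1 = 6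
negInverse₇ 2 = 3
negInverse₇ 3 = 2
negInverse₇ 4 = 5
negInverse₇ 5 = 4
negInverse₇ 6 = 1
negInverse₇ _ = 0

negInverse₇-spec : 0 < m → m < 7 → 7 ∣ negInverse₇ m ℕ.* m ℕ.+ 1
negInverse₇-spec {1} _ _ = divides 1 refl
negInverse₇-spec {2} _ _ = divides 1 refl
negInverse₇-spec {3} _ _ = divides 1 refl
negInverse₇-spec {4} _ _ = divides 3 refl
negInverse₇-spec {5} _ _ = divides 3 refl
negInverse₇-spec {6} _ _ = divides 1 refl
negInverse₇-spec {suc (suc (suc (suc (suc (suc (suc _))))))} _ (s≤s (s≤s (s≤s (s≤s (s≤s (s≤s (s≤s ())))))))

phase : Vec Bool² 7 → Fin 7
phase w = (negInverse₇ (count ℓ w) ℕ.* positionSum ℓ w) mod 7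
  where
  ℓ : Bool²
  ℓ = leader w

leader-count<7 : ∀ (w : Vec Bool² 7) → not (isConstant w) ≡ true → count (leader w) w < 7
leader-count<7 w nonconstant = ℕ.≤∧≢⇒< (Vec.count≤n (leader w ≟²_) w)
  (λ full → absurd (allEqual⇒isConstant (leader w) w (count≡length⇒allEqual (leader w) w full)) nonconstant)
  where
  absurd : ∀ {b} → b ≡ true → not b ≢ true
  absurd refl ()

phase-rotateˡ : ∀ (w : Vec Bool² 7) → not (isConstant w) ≡ true → phase (rotateˡ w) ≡ rot 1 (phase w)
phase-rotateˡ w@(x ∷ v) nonconstant
  rewrite leader-rotateˡ w | count-rotateˡ (leader w) w = begin
    (u ℕ.* positionSum ℓ (rotateˡ w)) mod 7
      ≡⟨ rot-cong (u ℕ.* positionSum ℓ (rotateˡ w)) zero (1 ℕ.+ u ℕ.* positionSum ℓ w) zero step ⟩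
    rot (1 ℕ.+ u ℕ.* positionSum ℓ w) zero
      ≡⟨ rot-rot (u ℕ.* positionSum ℓ w) 1 zero ⟨
    rot 1 ((u ℕ.* positionSum ℓ w) mod 7) ∎
  where
  open ≡-Reasoning
  ℓ : Bool²
  ℓ = leader w
  u : ℕ
  u = negInverse₇ (count ℓ w)
  step : (u ℕ.* positionSum ℓ (rotateˡ w)) % 7 ≡ (1 ℕ.+ u ℕ.* positionSum ℓ w) % 7
  step = mod-step {u = u} {m = count ℓ w} {S = positionSum ℓ w} {S′ = positionSum ℓ (rotateˡ w)} {e = count ℓ (x ∷ [])}
           (negInverse₇-spec (leader-present w) (leader-count<7 w nonconstant)) (positionSum-rotateˡ ℓ x v)

inClass : Fin 7 → Vec Bool² 7 → Bool
inClass j w = does (phase w Fin.≟ j) ∧ not (isConstant w)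

inClass-rotateˡ : ∀ j w → inClass (rot 1 j) (rotateˡ w) ≡ inClass j w
inClass-rotateˡ j w rewrite isConstant-rotateˡ w = ∧-congʳ-true (not (isConstant w)) (λ nonconstant →
  trans (cong (λ p → does (p Fin.≟ rot 1 j)) (phase-rotateˡ w nonconstant)) (does-rot-1 (phase w) j))

-- Non-constant words split into seven phase classes, which rotation permutes cyclically.
module RotationInvariant (H : Vec Bool² 7 → ℤ) (H-rotateˡ : ∀ w → H (rotateˡ w) ≡ H w) where

  classSum : Fin 7 → ℤ
  classSum j = sumVec pairs (λ w → 𝟙 (inClass j w) * H w)

  classSum-rot : ∀ j → classSum (rot 1 j) ≡ classSum j
  classSum-rot j = trans (sym (sumVec-rotateˡ pairs (λ w → 𝟙 (inClass (rot 1 j) w) * H w)))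
    (sumVec-cong pairs (λ w → cong₂ _*_ (cong 𝟙 (inClass-rotateˡ j w)) (H-rotateˡ w)))

  sumVec-nonConstant : sumVec pairs (λ w → 𝟙 (not (isConstant w)) * H w) ≡ + 7 * classSum zero
  sumVec-nonConstant = begin
    sumVec pairs (λ w → 𝟙 (not (isConstant w)) * H w)
      ≡⟨ sumVec-cong pairs spread ⟩
    sumVec pairs (λ w → sumOver (allFin 7) (λ j → 𝟙 (inClass j w) * H w))
      ≡⟨ sumVec-sumOver pairs (allFin 7) (λ j w → 𝟙 (inClass j w) * H w) ⟩
    sumOver (allFin 7) classSum
      ≡⟨ sumOver-cong (allFin 7) (rot-1-invariant⇒constant classSum classSum-rot) ⟩
    sumOver (allFin 7) (λ _ → classSum zero)
      ≡⟨ sumOver-const (allFin 7) (classSum zero) ⟩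
    + 7 * classSum zero ∎
    where
    open ≡-Reasoning
    spread : ∀ w → 𝟙 (not (isConstant w)) * H w ≡ sumOver (allFin 7) (λ j → 𝟙 (inClass j w) * H w)
    spread w = trans (sym (sumOver-allFin-δ 7 (phase w) (λ _ → 𝟙 (not (isConstant w)) * H w)))
      (sumOver-cong (allFin 7) (λ j → sym (𝟙-∧-* (does (phase w Fin.≟ j)) (not (isConstant w)) (H w))))

  sumVec-constant : sumVec pairs (λ w → 𝟙 (isConstant w) * H w) ≡ sumOver pairs (λ q → H (replicate 7 q))
  sumVec-constant = begin
    sumVec pairs (λ w → 𝟙 (isConstant w) * H w)
      ≡⟨ sumVec-cong pairs (λ w → trans (cong (_* H w) (𝟙-isConstant w))
                                        (sumOver-*ʳ pairs (λ q → 𝟙 (allEqual q w)) (H w))) ⟩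
    sumVec pairs (λ w → sumOver pairs (λ q → 𝟙 (allEqual q w) * H w))
      ≡⟨ sumVec-sumOver pairs pairs (λ q w → 𝟙 (allEqual q w) * H w) ⟩
    sumOver pairs (λ q → sumVec pairs (λ w → 𝟙 (allEqual q w) * H w))
      ≡⟨ sumOver-cong pairs (λ q → sumVec-allEqual q H) ⟩
    sumOver pairs (λ q → H (replicate 7 q)) ∎
    where open ≡-Reasoning

  sumVec-decomposition : sumVec pairs H ≡ sumOver pairs (λ q → H (replicate 7 q)) + + 7 * classSum zero
  sumVec-decomposition = begin
    sumVec pairs H
      ≡⟨ sumVec-cong pairs (λ w → 𝟙-split (isConstant w) (H w)) ⟩
    sumVec pairs (λ w → 𝟙 (isConstant w) * H w + 𝟙 (not (isConstant w)) * H w)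
      ≡⟨ sumVec-+ pairs _ _ ⟩
    sumVec pairs (λ w → 𝟙 (isConstant w) * H w) + sumVec pairs (λ w → 𝟙 (not (isConstant w)) * H w)
      ≡⟨ cong₂ _+_ sumVec-constant sumVec-nonConstant ⟩
    sumOver pairs (λ q → H (replicate 7 q)) + + 7 * classSum zero ∎
    where open ≡-Reasoning

empty-⊆ : ∀ (x : Input n) → lookup (replicate n false) ⊆ x
empty-⊆ x i = subst (λ b → b 𝔹.≤ x i) (sym (Vec.lookup-replicate i false)) (Bool.≤-minimum (x i))

⊆-full : ∀ (x : Input n) → x ⊆ lookup (replicate n true)
⊆-full x i = subst (x i 𝔹.≤_) (sym (Vec.lookup-replicate i true)) (Bool.≤-maximum (x i))

module _ {f : BoolFun n} (monotone : MonotoneNonIncreasing f) where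

  monotone-≗ : ∀ {x y} → (∀ i → x i ≡ y i) → f x ≡ f y
  monotone-≗ {x} {y} x≗y with f x in fx | f y in fy
  ... | true  | true  = refl
  ... | false | false = refl
  ... | true  | false = trans (sym (monotone x y (λ i → Bool.≤-reflexive (sym (x≗y i))) fx)) fy
  ... | false | true  = trans (sym fx) (monotone y x (λ i → Bool.≤-reflexive (x≗y i)) fy)

  nonTrivial⇒empty-true : NonTrivial f → f (lookup (replicate n false)) ≡ true
  nonTrivial⇒empty-true (x , y , fx≢fy) with f x in fx | f y in fy
  ... | true  | _     = monotone x _ (empty-⊆ x) fx
  ... | false | true  = monotone y _ (empty-⊆ y) fy
  ... | false | false = contradiction refl fx≢fy

  nonTrivial⇒full-false : NonTrivial f → f (lookup (replicate n true)) ≡ false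
  nonTrivial⇒full-false (x , y , fx≢fy) with f (lookup (replicate n true)) in full
  ... | false = refl
  ... | true  = contradiction (trans (monotone _ x (⊆-full x) full) (sym (monotone _ y (⊆-full y) full))) fx≢fy

sign-unpair-∷ʳ : ∀ (w : Vec Bool² n) a b → sign (unpair (w ∷ʳ (a , b))) ≡ sign (unpair w) * (signBit a * signBit b)
sign-unpair-∷ʳ []             a b = shuffle (signBit a) (signBit b)
  where shuffle : ∀ x y → x * (y * 1ℤ) ≡ 1ℤ * (x * y)
        shuffle = solve-∀
sign-unpair-∷ʳ ((c , d) ∷ w) a b =
  trans (cong (λ s → signBit c * (signBit d * s)) (sign-unpair-∷ʳ w a b))
        (shuffle (signBit c) (signBit d) (sign (unpair w)) (signBit a * signBit b))
  where shuffle : ∀ x y z t → x * (y * (z * t)) ≡ x * (y * z) * t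
        shuffle = solve-∀

sign-unpair-rotateˡ : ∀ (w : Vec Bool² (suc n)) → sign (unpair (rotateˡ w)) ≡ sign (unpair w)
sign-unpair-rotateˡ ((a , b) ∷ w) =
  trans (sign-unpair-∷ʳ w a b) (shuffle (sign (unpair w)) (signBit a) (signBit b))
  where shuffle : ∀ z x y → z * (x * y) ≡ x * (y * z)
        shuffle = solve-∀

lookup-unpair-rotateˡ : ∀ (w : Vec Bool² 7) a → lookup (unpair (rotateˡ w)) a ≡ lookup (unpair w) (rot 2 a)
lookup-unpair-rotateˡ w a =
  trans (cong (λ v → lookup v a) (tabulated w)) (Vec.lookup∘tabulate (λ a → lookup (unpair w) (rot 2 a)) a)
  where
  tabulated : ∀ w → unpair (rotateˡ w) ≡ Vec.tabulate (λ a → lookup (unpair w) (rot 2 a))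
  tabulated ((_ , _) ∷ (_ , _) ∷ (_ , _) ∷ (_ , _) ∷ (_ , _) ∷ (_ , _) ∷ (_ , _) ∷ []) = refl

repeated : Bool² → Input 14
repeated q = lookup (unpair (replicate 7 q))

repeated-01-rot-1 : ∀ a → repeated (false , true) a ≡ repeated (true , false) (rot 1 a)
repeated-01-rot-1 a =
  trans (cong (λ v → lookup v a) tabulated) (Vec.lookup∘tabulate (λ a → repeated (true , false) (rot 1 a)) a)
  where
  tabulated : unpair (replicate 7 (false , true)) ≡ Vec.tabulate (λ a → repeated (true , false) (rot 1 a))
  tabulated = refl

-- Pairing up the 14 variables turns rotation by two positions into rotateˡ on Vec Bool² 7.
weight : BoolFun 14 → Vec Bool² 7 → ℤ
weight f w = 𝟙 (f (lookup (unpair w))) * sign (unpair w)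

weight-rotateˡ : ∀ {f} → MonotoneNonIncreasing f → CyclicInvariant14 f → ∀ w → weight f (rotateˡ w) ≡ weight f w
weight-rotateˡ monotone invariant w = cong₂ _*_
  (cong 𝟙 (trans (monotone-≗ monotone (lookup-unpair-rotateˡ w)) (invariant 2 (lookup (unpair w)))))
  (sign-unpair-rotateˡ w)

-- The constant words of Vec Bool² 7 are ∅, (01)⁷, (10)⁷ and the full set, with signs +, -, -, +.
constant-weights : ∀ {f} → NonTrivial f → MonotoneNonIncreasing f → CyclicInvariant14 f →
  ∣ sumOver pairs (λ q → weight f (replicate 7 q)) ∣ ≡ 1
constant-weights nontrivial monotone invariant =
  signs (nonTrivial⇒empty-true monotone nontrivial) (nonTrivial⇒full-false monotone nontrivial)
        (sym (trans (monotone-≗ monotone repeated-01-rot-1) (invariant 1 (repeated (true , false)))))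
  where
  signs : ∀ {b₀ b₁ b₂ b₃} → b₀ ≡ true → b₃ ≡ false → b₂ ≡ b₁ →
    ∣ 𝟙 b₀ * 1ℤ + (𝟙 b₁ * -1ℤ + (𝟙 b₂ * -1ℤ + (𝟙 b₃ * 1ℤ + 0ℤ))) ∣ ≡ 1
  signs {b₁ = false} refl refl refl = refl
  signs {b₁ = true}  refl refl refl = refl

unit+7ℤ≢0 : ∀ c k → ∣ c ∣ ≡ 1 → c + + 7 * k ≢ 0ℤ
unit+7ℤ≢0 c k ∣c∣≡1 c+7k≡0 = contradiction (ℕ.m*n≡1⇒m≡1 7 ∣ k ∣ 7∣k∣≡1) λ ()
  where
  c≡-7k : c ≡ - (+ 7 * k)
  c≡-7k = trans (shuffle c (+ 7 * k)) (trans (cong (_+ - (+ 7 * k)) c+7k≡0) (ℤ.+-identityˡ _))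
    where shuffle : ∀ c x → c ≡ c + x + - x
          shuffle = solve-∀
  7∣k∣≡1 : 7 ℕ.* ∣ k ∣ ≡ 1
  7∣k∣≡1 = begin
    7 ℕ.* ∣ k ∣      ≡⟨ ℤ.abs-* (+ 7) k ⟨
    ∣ + 7 * k ∣      ≡⟨ ℤ.∣-i∣≡∣i∣ (+ 7 * k) ⟨
    ∣ - (+ 7 * k) ∣  ≡⟨ cong ∣_∣ c≡-7k ⟨
    ∣ c ∣            ≡⟨ ∣c∣≡1 ⟩
    1 ∎
    where open ≡-Reasoning

lemma1 : (f : BoolFun 14) → NonTrivial f → MonotoneNonIncreasing f →
    CyclicInvariant14 f → Elusive f
lemma1 f nontrivial monotone invariant = signedCount≢0⇒elusive f λ vanishes →
  unit+7ℤ≢0 constants (classSum zero) (constant-weights nontrivial monotone invariant) (begin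
    constants + + 7 * classSum zero  ≡⟨ sumVec-decomposition ⟨
    sumVec pairs (weight f)          ≡⟨ sumVec-unpair bools (λ v → 𝟙 (f (lookup v)) * sign v) ⟨
    signedCount f                    ≡⟨ vanishes ⟩
    0ℤ ∎)
  where
  open ≡-Reasoning
  open RotationInvariant (weight f) (weight-rotateˡ monotone invariant)
  constants : ℤ
  constants = sumOver pairs (λ q → weight f (replicate 7 q))
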